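{- Let $F$ be an integral $(2,2)$-form. If some pair $(a,b)$ is admissible for $F$, then at least one of the pairs $(0,0),(1,0),(0,1),(1,1),(2,1),(1,2)$ is admissible for $F$.
   Context: $K$ is a field with discrete valuation $v$, valuation ring $\mathcal{O}_K$ and uniformiser $\pi$. A $(2,2)$-form is a polynomial in $x_1,x_2,y_1,y_2$, homogeneous of degree $2$ in each pair of variables. It is integral if its coefficients are in $\mathcal{O}_K$. A pair $(a,b)$ of integers $a,b\ge0$ is admissible for an integral $(2,2)$-form $F$ if $\pi^{ -a-b-1}F(x_1,\pi^ax_2;y_1,\pi^by_2)$ has all coefficients in $\mathcal{O}_K$. -}

module Defs where

open import Level using (Level; _⊔_; suc)
open import Algebra.Bundles using (CommutativeRing)
open import Data.Nat as ℕ using (ℕ; zero) renaming (suc to sucℕ)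
open import Data.Integer as ℤ using (ℤ)
open import Data.Fin using (Fin; toℕ)
open import Data.Sum using (_⊎_)
open import Data.Product using (_×_; _,_; proj₂)
open import Relation.Binary.PropositionalEquality using (_≡_; refl) renaming (sym to ≡-sym; trans to ≡-trans)
open import Relation.Nullary using (¬_)
open import Data.Empty using (⊥)

data ℤ∞ : Set where
  fin : ℤ → ℤ∞
  ∞   : ℤ∞

infixl 6 _+∞_
_+∞_ : ℤ∞ → ℤ∞ → ℤ∞
fin m +∞ fin n = fin (m ℤ.+ n)
fin _ +∞ ∞     = ∞
∞     +∞ _     = ∞

infix 4 _≤∞_
data _≤∞_ : ℤ∞ → ℤ∞ → Set where
  fin≤fin : ∀ {m n} → m ℤ.≤ n → fin m ≤∞ fin n
  _≤∞∞    : ∀ x → x ≤∞ ∞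

record Field (c ℓ : Level) : Set (suc (c ⊔ ℓ)) where
  field
    commRing : CommutativeRing c ℓ
  open CommutativeRing commRing public
  field
    0≉1     : ¬ (0# ≈ 1#)
    inv     : (x : Carrier) → ¬ (x ≈ 0#) → Carrier
    inv-law : (x : Carrier) (nz : ¬ (x ≈ 0#)) → x * inv x nz ≈ 1#

  infixr 8 _^_
  _^_ : Carrier → ℕ → Carrier
  x ^ zero   = 1#
  x ^ sucℕ n = x * (x ^ n)

record DiscretelyValuedField (c ℓ : Level) : Set (suc (c ⊔ ℓ)) where
  field
    K : Field c ℓ
  open Field K public
  field
    v       : Carrier → ℤ∞
    v-cong  : ∀ {x y} → x ≈ y → v x ≡ v y
    v-∞     : ∀ x → (v x ≡ ∞ → x ≈ 0#) × (x ≈ 0# → v x ≡ ∞)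
    v-*     : ∀ x y → v (x * y) ≡ v x +∞ v y
    v-+     : ∀ x y → ((v x ≤∞ v (x + y)) ⊎ (v y ≤∞ v (x + y)))
    π       : Carrier
    v-π     : v π ≡ fin (ℤ.+ 1)

  InO : Carrier → Set
  InO x = fin (ℤ.+ 0) ≤∞ v x

  π≉0 : ¬ (π ≈ 0#)
  π≉0 p = absurd (≡-trans (≡-sym (proj₂ (v-∞ π) p)) v-π)
    where
      absurd : ∞ ≡ fin (ℤ.+ 1) → ⊥
      absurd ()

  π⁻¹ : Carrier
  π⁻¹ = inv π π≉0

  -- (2,2)-forms.  A (2,2)-form
  --   F = Σ_{i,j ∈ {0,1,2}} c i j · x1^(2-i) x2^i y1^(2-j) y2^j
  -- is represented by its coefficient table c.

  Form22 : Set c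
  Form22 = Fin 3 → Fin 3 → Carrier

  Integral : Form22 → Set
  Integral F = ∀ i j → InO (F i j)

  -- coefficients of π^(-a-b-1) · F(x1, π^a x2 ; y1, π^b y2):
  -- the (i,j)-coefficient is π^(-(a+b+1)) · π^(a i + b j) · c i j
  rescale : ℕ → ℕ → Form22 → Form22
  rescale a b F i j =
    (π⁻¹ ^ (a ℕ.+ b ℕ.+ 1)) * ((π ^ (a ℕ.* toℕ i ℕ.+ b ℕ.* toℕ j)) * F i j)

  Admissible : Form22 → ℕ → ℕ → Set
  Admissible F a b = Integral (rescale a b F)

-- Write n for the valuation of the coefficient of x₁^(2-i) x₂^i y₁^(2-j) y₂^j.  Then (a, b)
-- is admissible iff a + b + 1 ≤ a i + b j + n at every nonzero coefficient.  Each of these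
-- conditions survives three moves: lowering a by one to a value still above b (only the
-- row i = 2 gets a stronger bound, and there it holds outright as a + b + 1 ≤ 2a), the
-- symmetric move on b, and lowering both by one while both stay positive (only i + j > 2
-- gets a stronger bound, again holding outright).  These moves take every pair to one of
-- the six.
module Submission where

open import Defs
open import Level using (Level)
open import Data.Empty using (⊥-elim)
open import Data.Fin using (Fin; toℕ; zero; suc)
open import Data.Integer as ℤ using (+_; -[1+_]; 0ℤ; 1ℤ; +≤+)
import Data.Integer.Properties as ℤP
open import Algebra.Properties.AbelianGroup ℤP.+-0-abelianGroup
  using (identityʳ-unique; inverseʳ-unique)
open import Data.List using (_∷_; [])
open import Data.Nat using (ℕ; zero; suc; _+_; _*_; _≤_; _<_; z≤n; s≤s)
open import Data.Nat.Properties
  using ( ≤-refl; ≤-trans; m≤m+n; +-monoˡ-≤; +-cancelˡ-≤; ≤″⇒≤; m≤n⇒∃[o]m+o≡n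
        ; module ≤-Reasoning)
open import Data.Nat.Tactic.RingSolver using (solve)
open import Algebra.Definitions.RawMagma using () renaming (_,_ to _,≤″_)
open import Data.Product using (∃₂; _,_; proj₁)
open import Data.Sum using (_⊎_; inj₁; inj₂; map)
open import Function.Base using (_∘_)
open import Relation.Binary.PropositionalEquality
  using (_≡_; _≢_; refl; sym; trans; cong; cong₂; subst; module ≡-Reasoning)

AdmissibleAt : ℕ → ℕ → ℕ → ℕ → ℕ → Set
AdmissibleAt a b I J n = a + b + 1 ≤ a * I + b * J + n

-- A record rather than a function type, so that its indices can be inferred.
record Entails (a b a′ b′ : ℕ) : Set where
  constructor entails
  field
    transfer : ∀ (i j : Fin 3) n →
      AdmissibleAt a b (toℕ i) (toℕ j) n → AdmissibleAt a′ b′ (toℕ i) (toℕ j) n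

open Entails

Entails-refl : ∀ {a b} → Entails a b a b
Entails-refl = entails λ i j n h → h

Entails-trans : ∀ {a b a′ b′ a″ b″} →
  Entails a b a′ b′ → Entails a′ b′ a″ b″ → Entails a b a″ b″
Entails-trans e f = entails λ i j n → transfer f i j n ∘ transfer e i j n

AdmissibleAt-lower : ∀ δa δb a b I J n → δa * I + δb * J ≤ δa + δb →
  AdmissibleAt (δa + a) (δb + b) I J n → AdmissibleAt a b I J n
AdmissibleAt-lower δa δb a b I J n small h = +-cancelˡ-≤ (δa + δb) _ _ (begin
  δa + δb + (a + b + 1)                     ≡⟨ solve (δa ∷ δb ∷ a ∷ b ∷ []) ⟩
  δa + a + (δb + b) + 1                     ≤⟨ h ⟩
  (δa + a) * I + (δb + b) * J + n           ≡⟨ solve (δa ∷ δb ∷ a ∷ b ∷ I ∷ J ∷ n ∷ []) ⟩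
  δa * I + δb * J + (a * I + b * J + n)     ≤⟨ +-monoˡ-≤ _ small ⟩
  δa + δb + (a * I + b * J + n)             ∎)
  where open ≤-Reasoning

Entails-lower : ∀ δa δb a b →
  (∀ (i j : Fin 3) →
    δa * toℕ i + δb * toℕ j ≤ δa + δb ⊎ a + b + 1 ≤ a * toℕ i + b * toℕ j) →
  Entails (δa + a) (δb + b) a b
Entails-lower δa δb a b criterion = entails transfer′
  where
  transfer′ : ∀ (i j : Fin 3) n →
    AdmissibleAt (δa + a) (δb + b) (toℕ i) (toℕ j) n → AdmissibleAt a b (toℕ i) (toℕ j) n
  transfer′ i j n h with criterion i j
  ... | inj₁ small   = AdmissibleAt-lower δa δb a b (toℕ i) (toℕ j) n small h
  ... | inj₂ vacuous = ≤-trans vacuous (m≤m+n _ n)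

-- ≤″⇒≤ with the witness equation in terms of _+_, where `solve` can prove it.
≤-by-excess : ∀ {m n} k → m + k ≡ n → m ≤ n
≤-by-excess k m+k≡n = ≤″⇒≤ (k ,≤″ m+k≡n)

b<a⇒a+b+1≤a*2+b*J : ∀ {a b} J → b < a → a + b + 1 ≤ a * 2 + b * J
b<a⇒a+b+1≤a*2+b*J {b = b} J b<a with m≤n⇒∃[o]m+o≡n b<a
... | k , refl = ≤-by-excess (k + b * J) (solve (b ∷ k ∷ J ∷ []))

a<b⇒a+b+1≤a*I+b*2 : ∀ {a b} I → a < b → a + b + 1 ≤ a * I + b * 2
a<b⇒a+b+1≤a*I+b*2 {a} I a<b with m≤n⇒∃[o]m+o≡n a<b
... | k , refl = ≤-by-excess (k + a * I) (solve (a ∷ k ∷ I ∷ []))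

Entails-lower-a : ∀ {a b} → b < a → Entails (suc a) b a b
Entails-lower-a {a} {b} b<a = Entails-lower 1 0 a b criterion
  where
  criterion : ∀ (i j : Fin 3) → 1 * toℕ i + 0 * toℕ j ≤ 1 ⊎ a + b + 1 ≤ a * toℕ i + b * toℕ j
  criterion zero             j = inj₁ z≤n
  criterion (suc zero)       j = inj₁ ≤-refl
  criterion (suc (suc zero)) j = inj₂ (b<a⇒a+b+1≤a*2+b*J (toℕ j) b<a)

Entails-lower-b : ∀ {a b} → a < b → Entails a (suc b) a b
Entails-lower-b {a} {b} a<b = Entails-lower 0 1 a b criterion
  where
  criterion : ∀ (i j : Fin 3) → 0 * toℕ i + 1 * toℕ j ≤ 1 ⊎ a + b + 1 ≤ a * toℕ i + b * toℕ j
  criterion i zero             = inj₁ z≤n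
  criterion i (suc zero)       = inj₁ ≤-refl
  criterion i (suc (suc zero)) = inj₂ (a<b⇒a+b+1≤a*I+b*2 (toℕ i) a<b)

Entails-lower-both : ∀ a b → Entails (suc (suc a)) (suc (suc b)) (suc a) (suc b)
Entails-lower-both a b = Entails-lower 1 1 (suc a) (suc b) criterion
  where
  criterion : ∀ (i j : Fin 3) →
    1 * toℕ i + 1 * toℕ j ≤ 2 ⊎ suc a + suc b + 1 ≤ suc a * toℕ i + suc b * toℕ j
  criterion zero             zero             = inj₁ z≤n
  criterion zero             (suc zero)       = inj₁ (s≤s z≤n)
  criterion zero             (suc (suc zero)) = inj₁ ≤-refl
  criterion (suc zero)       zero             = inj₁ (s≤s z≤n)
  criterion (suc zero)       (suc zero)       = inj₁ ≤-refl
  criterion (suc zero)       (suc (suc zero)) = inj₂ (≤-by-excess b (solve (a ∷ b ∷ [])))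
  criterion (suc (suc zero)) zero             = inj₁ ≤-refl
  criterion (suc (suc zero)) (suc zero)       = inj₂ (≤-by-excess a (solve (a ∷ b ∷ [])))
  criterion (suc (suc zero)) (suc (suc zero)) = inj₂ (≤-by-excess (a + b + 1) (solve (a ∷ b ∷ [])))

HoldsAtSmallPair : (ℕ → ℕ → Set) → Set
HoldsAtSmallPair P = P 0 0 ⊎ P 1 0 ⊎ P 0 1 ⊎ P 1 1 ⊎ P 2 1 ⊎ P 1 2

HoldsAtSmallPair-map : ∀ {P Q : ℕ → ℕ → Set} →
  (∀ a b → P a b → Q a b) → HoldsAtSmallPair P → HoldsAtSmallPair Q
HoldsAtSmallPair-map f =
  map (f 0 0) (map (f 1 0) (map (f 0 1) (map (f 1 1) (map (f 2 1) (f 1 2)))))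

smallPair-entailed-via : ∀ {a b a′ b′} → Entails a b a′ b′ →
  HoldsAtSmallPair (Entails a′ b′) → HoldsAtSmallPair (Entails a b)
smallPair-entailed-via {a} {b} {a′} {b′} e =
  HoldsAtSmallPair-map {Entails a′ b′} {Entails a b} (λ _ _ → Entails-trans e)

smallPair-entailed : ∀ a b → HoldsAtSmallPair (Entails a b)
smallPair-entailed 0 0 = inj₁ Entails-refl
smallPair-entailed 1 0 = inj₂ (inj₁ Entails-refl)
smallPair-entailed 0 1 = inj₂ (inj₂ (inj₁ Entails-refl))
smallPair-entailed 1 1 = inj₂ (inj₂ (inj₂ (inj₁ Entails-refl)))
smallPair-entailed 2 1 = inj₂ (inj₂ (inj₂ (inj₂ (inj₁ Entails-refl))))
smallPair-entailed 1 2 = inj₂ (inj₂ (inj₂ (inj₂ (inj₂ Entails-refl))))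
smallPair-entailed (suc (suc a)) 0 =
  smallPair-entailed-via (Entails-lower-a (s≤s z≤n)) (smallPair-entailed (suc a) 0)
smallPair-entailed 0 (suc (suc b)) =
  smallPair-entailed-via (Entails-lower-b (s≤s z≤n)) (smallPair-entailed 0 (suc b))
smallPair-entailed (suc (suc (suc a))) 1 =
  smallPair-entailed-via (Entails-lower-a (s≤s (s≤s z≤n))) (smallPair-entailed (suc (suc a)) 1)
smallPair-entailed 1 (suc (suc (suc b))) =
  smallPair-entailed-via (Entails-lower-b (s≤s (s≤s z≤n))) (smallPair-entailed 1 (suc (suc b)))
smallPair-entailed (suc (suc a)) (suc (suc b)) =
  smallPair-entailed-via (Entails-lower-both a b) (smallPair-entailed (suc a) (suc b))

fin-injective : ∀ {m n} → fin m ≡ fin n → m ≡ n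
fin-injective refl = refl

x+∞x≡x⇒x≡0 : ∀ x → x ≢ ∞ → x +∞ x ≡ x → x ≡ fin 0ℤ
x+∞x≡x⇒x≡0 (fin k) _   eq = cong fin (identityʳ-unique k k (fin-injective eq))
x+∞x≡x⇒x≡0 ∞       x≢∞ _  = ⊥-elim (x≢∞ refl)

k+∞x≡0⇒x≡-k : ∀ k x → fin k +∞ x ≡ fin 0ℤ → x ≡ fin (ℤ.- k)
k+∞x≡0⇒x≡-k k (fin m) eq = cong fin (inverseʳ-unique k m (fin-injective eq))
k+∞x≡0⇒x≡-k k ∞       ()

0≤-m+n⇒m≤n : ∀ m n → 0ℤ ℤ.≤ ℤ.- (+ m) ℤ.+ + n → m ≤ n
0≤-m+n⇒m≤n m n 0≤-m+n =
  ℤP.drop‿+≤+ (ℤP.0≤i-j⇒j≤i (subst (0ℤ ℤ.≤_) (ℤP.+-comm (ℤ.- + m) (+ n)) 0≤-m+n))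

m≤n⇒0≤-m+n : ∀ {m n} → m ≤ n → 0ℤ ℤ.≤ ℤ.- (+ m) ℤ.+ + n
m≤n⇒0≤-m+n {m} {n} m≤n = subst (0ℤ ℤ.≤_) (ℤP.+-comm (+ n) (ℤ.- + m)) (ℤP.i≤j⇒0≤j-i (+≤+ m≤n))

shift : ℕ → ℕ → ℤ∞ → ℤ∞
shift N M x = fin (ℤ.- + N) +∞ (fin (+ M) +∞ x)

Entails-shift-nonneg : ∀ {a b a′ b′} → Entails a b a′ b′ →
  ∀ (i j : Fin 3) x → fin 0ℤ ≤∞ x →
  fin 0ℤ ≤∞ shift (a + b + 1) (a * toℕ i + b * toℕ j) x →
  fin 0ℤ ≤∞ shift (a′ + b′ + 1) (a′ * toℕ i + b′ * toℕ j) x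
Entails-shift-nonneg e i j ∞              _            _           = _ ≤∞∞
Entails-shift-nonneg e i j (fin (+ n))    _            (fin≤fin p) =
  fin≤fin (m≤n⇒0≤-m+n (transfer e i j n (0≤-m+n⇒m≤n _ _ p)))
Entails-shift-nonneg e i j (fin -[1+ n ]) (fin≤fin ()) _

module _ {c ℓ : Level} (D : DiscretelyValuedField c ℓ) where
  open DiscretelyValuedField D
    using (v; v-cong; v-∞; v-*; v-π; π; π⁻¹; π≉0; inv-law; 0≉1; 1#; _^_; *-identityˡ;
           Form22; Integral; Admissible; rescale)
    renaming (_*_ to _·_; sym to ≈-sym)
  open ≡-Reasoning

  v-1# : v 1# ≡ fin 0ℤ
  v-1# = x+∞x≡x⇒x≡0 (v 1#) v-1#≢∞ (begin
    v 1# +∞ v 1#  ≡⟨ sym (v-* 1# 1#) ⟩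
    v (1# · 1#)   ≡⟨ v-cong (*-identityˡ 1#) ⟩
    v 1#          ∎)
    where
    v-1#≢∞ : v 1# ≢ ∞
    v-1#≢∞ v1≡∞ = 0≉1 (≈-sym (proj₁ (v-∞ 1#) v1≡∞))

  v-π⁻¹ : v π⁻¹ ≡ fin ℤ.-1ℤ
  v-π⁻¹ = k+∞x≡0⇒x≡-k 1ℤ (v π⁻¹) (begin
    fin 1ℤ +∞ v π⁻¹  ≡⟨ cong (_+∞ v π⁻¹) (sym v-π) ⟩
    v π +∞ v π⁻¹     ≡⟨ sym (v-* π π⁻¹) ⟩
    v (π · π⁻¹)      ≡⟨ v-cong (inv-law π π≉0) ⟩
    v 1#             ≡⟨ v-1# ⟩
    fin 0ℤ           ∎)

  v-^ : ∀ {x k} → v x ≡ fin k → ∀ n → v (x ^ n) ≡ fin (+ n ℤ.* k)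
  v-^ vx≡k zero = v-1#
  v-^ {x} {k} vx≡k (suc n) = begin
    v (x · x ^ n)         ≡⟨ v-* x (x ^ n) ⟩
    v x +∞ v (x ^ n)      ≡⟨ cong₂ _+∞_ vx≡k (v-^ vx≡k n) ⟩
    fin (k ℤ.+ + n ℤ.* k) ≡⟨ cong fin (sym (ℤP.suc-* (+ n) k)) ⟩
    fin (+ suc n ℤ.* k)   ∎

  v-rescale : ∀ (F : Form22) a b (i j : Fin 3) →
    v (rescale a b F i j) ≡ shift (a + b + 1) (a * toℕ i + b * toℕ j) (v (F i j))
  v-rescale F a b i j = begin
    v (π⁻¹ ^ N · (π ^ M · F i j))        ≡⟨ v-* _ _ ⟩
    v (π⁻¹ ^ N) +∞ v (π ^ M · F i j)     ≡⟨ cong (v (π⁻¹ ^ N) +∞_) (v-* _ _) ⟩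
    v (π⁻¹ ^ N) +∞ (v (π ^ M) +∞ v (F i j))
      ≡⟨ cong₂ (λ x y → x +∞ (y +∞ v (F i j))) (v-π⁻¹^ N) (v-π^ M) ⟩
    shift N M (v (F i j))                ∎
    where
    N = a + b + 1
    M = a * toℕ i + b * toℕ j
    v-π^ : ∀ n → v (π ^ n) ≡ fin (+ n)
    v-π^ n = trans (v-^ v-π n) (cong fin (ℤP.*-identityʳ (+ n)))
    v-π⁻¹^ : ∀ n → v (π⁻¹ ^ n) ≡ fin (ℤ.- + n)
    v-π⁻¹^ n = trans (v-^ v-π⁻¹ n) (cong fin (trans (ℤP.*-comm (+ n) ℤ.-1ℤ) (ℤP.-1*i≡-i (+ n))))

  Admissible-entails : ∀ {F a b a′ b′} → Integral F → Admissible F a b → Entails a b a′ b′ →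
    Admissible F a′ b′
  Admissible-entails {F} {a} {b} {a′} {b′} integral admissible e i j =
    subst (fin 0ℤ ≤∞_) (sym (v-rescale F a′ b′ i j))
      (Entails-shift-nonneg e i j (v (F i j)) (integral i j)
        (subst (fin 0ℤ ≤∞_) (v-rescale F a b i j) (admissible i j)))

lemma2p5 : {c ℓ : Level} (D : DiscretelyValuedField c ℓ) →
    let open DiscretelyValuedField D in
    (F : Form22) → Integral F → ∃₂ (λ a b → Admissible F a b) →
    Admissible F 0 0 ⊎ Admissible F 1 0 ⊎ Admissible F 0 1 ⊎
    Admissible F 1 1 ⊎ Admissible F 2 1 ⊎ Admissible F 1 2
lemma2p5 D F integral (a , b , admissible) =
  HoldsAtSmallPair-map {Entails a b} {DiscretelyValuedField.Admissible D F}
    (λ _ _ → Admissible-entails D integral admissible) (smallPair-entailed a b)
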